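{- Let $m$ be an odd positive integer and let $a_1,\dots,a_m\ge2$ be integers, and let $N=\min\{a_1,a_2,\dots,a_m\}$. Then \[R_{C_m}(a_1,a_2,\dots,a_m)=R_{C_m}(N,N,\dots,N).\]
   Context: $C_m\le S_m$ denotes the cyclic group generated by the $m$-cycle $(1\,2\,\cdots\,m)$. An $m$-edge-coloured complete graph is a complete graph with each edge coloured from $[m]=\{1,\dots,m\}$. For $\Gamma\le S_m$, $\pi\in\Gamma$ and a vertex $v$, switching at $v$ with $\pi$ recolours every edge incident with $v$ of colour $i$ to colour $\pi(i)$, leaving other edges unchanged. Two such graphs on the same vertex set are $\Gamma$-switch equivalent if one is obtained from the other by a finite sequence of switches. $K_t^{(i)}$ is a complete graph on $t$ vertices with all edges of colour $i$. $R_\Gamma(a_1,\dots,a_m)$ is the least $n$ such that every $m$-edge-coloured complete graph on $n$ vertices is $\Gamma$-switch equivalent to one containing, for some $i$, a copy of $K_{a_i}^{(i)}$. -}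

module Defs where

open import Data.Nat using (ℕ; zero; suc; _+_; _≤_; NonZero)
open import Data.Nat.DivMod using (_%_; m%n<n)
open import Data.Fin using (Fin; toℕ; fromℕ<)
open import Data.Product using (Σ; ∃; ∃-syntax; _×_; _,_)
open import Relation.Binary.PropositionalEquality using (_≡_; _≢_)
open import Relation.Nullary using (¬_)
open import Relation.Binary.Construct.Closure.ReflexiveTransitive using (Star)
open import Data.Bool using (Bool; true; false; if_then_else_; _xor_)
open import Relation.Nullary.Decidable using (⌊_⌋)
open import Data.Fin.Properties using (_≟_)
open import Function using (_∘_)

cyc : (m : ℕ) → .{{_ : NonZero m}} → Fin m → Fin m
cyc m i = fromℕ< (m%n<n (suc (toℕ i)) m)

-- The elements of C_m are exactly the powers cyc^k, k : ℕ.
cycPow : (m : ℕ) → .{{_ : NonZero m}} → ℕ → Fin m → Fin m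
cycPow m zero    i = i
cycPow m (suc k) i = cyc m (cycPow m k i)

-- An m-edge-coloured complete graph on vertex set Fin n:
-- a symmetric colour function (its diagonal values are irrelevant).
record Colouring (n m : ℕ) : Set where
  field
    col : Fin n → Fin n → Fin m
    sym : ∀ u w → col u w ≡ col w u
open Colouring public

incident : ∀ {n} → Fin n → Fin n → Fin n → Bool
incident v u w = ⌊ u ≟ v ⌋ xor ⌊ w ≟ v ⌋

switchCol : ∀ {n} (m : ℕ) → .{{_ : NonZero m}} →
            Fin n → ℕ → (Fin n → Fin n → Fin m) → Fin n → Fin n → Fin m
switchCol m v k c u w = if incident v u w then cycPow m k (c u w) else c u w

SwitchStep : ∀ {n} (m : ℕ) → .{{_ : NonZero m}} → Colouring n m → Colouring n m → Set
SwitchStep m c₁ c₂ =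
  ∃[ v ] ∃[ k ] (∀ u w → col c₂ u w ≡ switchCol m v k (col c₁) u w)

SwitchEquiv : ∀ {n} (m : ℕ) → .{{_ : NonZero m}} → Colouring n m → Colouring n m → Set
SwitchEquiv m = Star (SwitchStep m)

ContainsMono : ∀ {n m} → Colouring n m → ℕ → Fin m → Set
ContainsMono {n} c t i =
  Σ (Fin t → Fin n) λ f →
    (∀ x y → f x ≡ f y → x ≡ y) ×
    (∀ x y → x ≢ y → col c (f x) (f y) ≡ i)

Arrows : (m : ℕ) → .{{_ : NonZero m}} → (Fin m → ℕ) → ℕ → Set
Arrows m a n =
  ∀ (c : Colouring n m) → ∃[ c' ] (SwitchEquiv m c c' × ∃[ i ] ContainsMono c' (a i) i)

IsRamseyC : (m : ℕ) → .{{_ : NonZero m}} → (Fin m → ℕ) → ℕ → Set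
IsRamseyC m a n = Arrows m a n × (∀ n' → Arrows m a n' → n ≤ n')

-- Switching at v with cyc^k adds k (mod m) to the colour of every edge at v, so a sequence of
-- switches acts through a potential y on the vertices, adding y u + y w to the colour of uw.
-- Switching every vertex by the same h adds 2h to all colours, and for odd m every residue is
-- of the form 2h; so a monochromatic K_N of one colour switches to one of any other colour.
-- Hence, for N = a j minimal, a colouring switches to one containing some K_{a_i}^{(i)} iff it
-- switches to one containing some monochromatic K_N, and the two arrow properties agree for
-- every n. A least such n exists: the arrow property holds for large n by Ramsey's theorem,
-- and it is decidable because potentials can be taken modulo m, making it a finite search.
module Submission where

open import Defs
open import Data.Nat using (ℕ; _≤_; _%_; NonZero)
open import Data.Fin using (Fin)
open import Data.Product using (∃; ∃-syntax; _×_)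
open import Relation.Binary.PropositionalEquality using (_≡_)

open import Data.Nat as ℕ using (zero; suc; _+_; _*_; _∸_; _<_; _/_; s≤s; _<?_)
open import Data.Nat.Properties
  using (+-identityʳ; +-assoc; +-comm; +-suc; ≤-refl; ≤-reflexive; <-≤-trans; <⇒≤; <-irrefl;
         ≮⇒≥; m≤n⇒m≤1+n; ≤∧≢⇒<; +-monoˡ-≤; +-cancelˡ-<; m+[n∸m]≡n; anyUpTo?; module ≤-Reasoning)
  renaming (<-cmp to ℕ-<-cmp)
open import Data.Nat.DivMod
  using (%-distribˡ-+; m%n%n≡m%n; m<n⇒m%n≡m; m%n<n; m≡m%n+[m/n]*n; [m+kn]%n≡m%n; [m+n]%n≡m%n)
open import Data.Nat.Induction using (<-wellFounded)
open import Data.Nat.Solver using (module +-*-Solver)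
open import Data.Fin as Fin using (toℕ; fromℕ<; inject≤; finToFun; funToFin)
open import Data.Fin.Properties
  using (_≟_; toℕ-fromℕ<; toℕ-injective; toℕ<n; inject≤-injective; any?; all?; <-cmp; finToFun-funToFin)
open import Data.Product using (Σ; _,_; proj₁; proj₂)
open import Data.Bool using (if_then_else_)
open import Data.Bool.Properties using (xor-comm)
open import Data.Empty using (⊥-elim)
open import Data.List using (List; []; _∷_; length; map; lookup; filter; allFin)
open import Data.List.Properties using (length-tabulate)
open import Data.List.Relation.Unary.All as All using (All; []; _∷_)
import Data.List.Relation.Unary.All.Properties as All
open import Data.List.Relation.Unary.AllPairs using (AllPairs; []; _∷_)
import Data.List.Relation.Unary.AllPairs.Properties as AllPairs
open import Data.List.Relation.Unary.Unique.Propositional using (Unique)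
import Data.List.Relation.Unary.Unique.Propositional.Properties as Unique
open import Data.List.Relation.Binary.Sublist.Propositional using (_⊆_; []; _∷_; minimum; ⊆-trans)
open import Data.List.Relation.Binary.Sublist.Propositional.Properties as Sublist
  using (All-resp-⊆; filter-⊆; length-mono-≤)
open import Data.List.Membership.Propositional.Properties using (∈-lookup)
open import Function using (_∘_)
open import Induction.WellFounded using (Acc; acc)
open import Relation.Binary.Construct.Closure.ReflexiveTransitive using (ε; _◅_; _◅◅_)
open import Relation.Binary.Definitions using (tri<; tri≈; tri>)
open import Relation.Binary.PropositionalEquality as ≡
  using (_≢_; _≗_; refl; cong; cong₂; trans; subst₂; module ≡-Reasoning)
open import Relation.Nullary using (Dec; yes; no; ¬_; ¬?; _×-dec_; _→-dec_)
open import Relation.Nullary.Decidable using (⌊_⌋; map′; decidable-stable)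
open import Relation.Unary using (Decidable)

x+0+0≡x : ∀ x → x + 0 + 0 ≡ x
x+0+0≡x x = trans (+-identityʳ (x + 0)) (+-identityʳ x)

module _ (m : ℕ) .{{_ : NonZero m}} where

  [a%m+b]%m≡[a+b]%m : ∀ a b → (a % m + b) % m ≡ (a + b) % m
  [a%m+b]%m≡[a+b]%m a b = begin
    (a % m + b) % m          ≡⟨ %-distribˡ-+ (a % m) b m ⟩
    (a % m % m + b % m) % m  ≡⟨ cong (λ z → (z + b % m) % m) (m%n%n≡m%n a m) ⟩
    (a % m + b % m) % m      ≡⟨ ≡.sym (%-distribˡ-+ a b m) ⟩
    (a + b) % m              ∎
    where open ≡-Reasoning

  [a+b%m]%m≡[a+b]%m : ∀ a b → (a + b % m) % m ≡ (a + b) % m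
  [a+b%m]%m≡[a+b]%m a b = begin
    (a + b % m) % m  ≡⟨ cong (_% m) (+-comm a (b % m)) ⟩
    (b % m + a) % m  ≡⟨ [a%m+b]%m≡[a+b]%m b a ⟩
    (b + a) % m      ≡⟨ cong (_% m) (+-comm b a) ⟩
    (a + b) % m      ∎
    where open ≡-Reasoning

  [a+b%m+c%m]%m≡[a+b+c]%m : ∀ a b c → (a + b % m + c % m) % m ≡ (a + b + c) % m
  [a+b%m+c%m]%m≡[a+b+c]%m a b c = begin
    (a + b % m + c % m) % m    ≡⟨ [a+b%m]%m≡[a+b]%m (a + b % m) c ⟩
    (a + b % m + c) % m        ≡⟨ cong (_% m) (+-assoc a (b % m) c) ⟩
    (a + (b % m + c)) % m      ≡⟨ ≡.sym ([a+b%m]%m≡[a+b]%m a (b % m + c)) ⟩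
    (a + (b % m + c) % m) % m  ≡⟨ cong (λ z → (a + z) % m) ([a%m+b]%m≡[a+b]%m b c) ⟩
    (a + (b + c) % m) % m      ≡⟨ [a+b%m]%m≡[a+b]%m a (b + c) ⟩
    (a + (b + c)) % m          ≡⟨ cong (_% m) (≡.sym (+-assoc a b c)) ⟩
    (a + b + c) % m            ∎
    where open ≡-Reasoning

  toℕ≡toℕ%m : (i : Fin m) → toℕ i ≡ toℕ i % m
  toℕ≡toℕ%m i = ≡.sym (m<n⇒m%n≡m (toℕ<n i))

  toℕ-cycPow : ∀ k (i : Fin m) → toℕ (cycPow m k i) ≡ (toℕ i + k) % m
  toℕ-cycPow zero    i = trans (toℕ≡toℕ%m i) (cong (_% m) (≡.sym (+-identityʳ _)))
  toℕ-cycPow (suc k) i = begin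
    toℕ (cyc m (cycPow m k i))    ≡⟨ toℕ-fromℕ< (m%n<n (suc (toℕ (cycPow m k i))) m) ⟩
    (1 + toℕ (cycPow m k i)) % m  ≡⟨ cong (λ z → (1 + z) % m) (toℕ-cycPow k i) ⟩
    (1 + (toℕ i + k) % m) % m     ≡⟨ [a+b%m]%m≡[a+b]%m 1 (toℕ i + k) ⟩
    (1 + (toℕ i + k)) % m         ≡⟨ cong (_% m) (≡.sym (+-suc (toℕ i) k)) ⟩
    (toℕ i + suc k) % m           ∎
    where open ≡-Reasoning

  -- With m = 2q + 1, h = (q + 1)(b + m ∸ a) gives 2h = (b + m ∸ a)(m + 1) ≡ b - a.
  odd⇒halvable : m % 2 ≡ 1 → ∀ a b → a ≤ m → ∃ λ h → (a + h + h) % m ≡ b % m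
  odd⇒halvable m%2≡1 a b a≤m = h , (begin
    (a + h + h) % m                ≡⟨ cong (_% m) (double a q D) ⟩
    (a + D + D * suc (q * 2)) % m  ≡⟨ cong (λ k → (a + D + D * k) % m) (≡.sym m≡2q+1) ⟩
    (a + D + D * m) % m            ≡⟨ [m+kn]%n≡m%n (a + D) D m ⟩
    (a + D) % m                    ≡⟨ cong (_% m) a+D≡b+m ⟩
    (b + m) % m                    ≡⟨ [m+n]%n≡m%n b m ⟩
    b % m                          ∎)
    where
    open ≡-Reasoning
    open +-*-Solver
    q = m / 2
    m≡2q+1 : m ≡ suc (q * 2)
    m≡2q+1 = trans (m≡m%n+[m/n]*n m 2) (cong (_+ q * 2) m%2≡1)
    D = b + (m ∸ a)
    h = suc q * D
    double : ∀ a q d → a + suc q * d + suc q * d ≡ a + d + d * suc (q * 2)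
    double = solve 3 (λ a q d → a :+ (con 1 :+ q) :* d :+ (con 1 :+ q) :* d
                                := a :+ d :+ d :* (con 1 :+ q :* con 2)) refl
    a+D≡b+m : a + D ≡ b + m
    a+D≡b+m = begin
      a + (b + (m ∸ a))  ≡⟨ solve 3 (λ a b r → a :+ (b :+ r) := b :+ (a :+ r)) refl a b (m ∸ a) ⟩
      b + (a + (m ∸ a))  ≡⟨ cong (b +_) (m+[n∸m]≡n a≤m) ⟩
      b + m              ∎

∃-fun? : ∀ {n m} {P : (Fin n → Fin m) → Set} →
         (∀ {f g} → f ≗ g → P f → P g) → Decidable P → Dec (∃ P)
∃-fun? resp P? = map′ (λ (k , p) → finToFun k , p)
                      (λ (f , p) → funToFin f , resp (≡.sym ∘ finToFun-funToFin f) p)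
                      (any? (P? ∘ finToFun))

∃-fun₂? : ∀ {n n′ m} {P : (Fin n → Fin n′ → Fin m) → Set} →
          (∀ {f g} → (∀ u → f u ≗ g u) → P f → P g) → Decidable P → Dec (∃ P)
∃-fun₂? resp P? = map′ (λ (h , p) → finToFun ∘ h , p)
                       (λ (f , p) → funToFin ∘ f , resp (λ u → ≡.sym ∘ finToFun-funToFin (f u)) p)
                       (∃-fun? (λ e → resp (λ u w → cong (λ k → finToFun k w) (e u)))
                               (P? ∘ (finToFun ∘_)))

Least : (ℕ → Set) → ℕ → Set
Least P k = P k × (∀ k′ → P k′ → k ≤ k′)

least : ∀ {P : ℕ → Set} → Decidable P → ∀ {n} → P n → ∃ (Least P)
least {P} P? {n} = go n (<-wellFounded n)
  where
  go : ∀ n → Acc _<_ n → P n → ∃ (Least P)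
  go n (acc smaller) pn with anyUpTo? P? n
  ... | yes (k , k<n , pk) = go k (smaller k<n) pk
  ... | no ∄smaller        = n , pn , λ k pk → ≮⇒≥ (λ k<n → ∄smaller (k , k<n , pk))

HasMonoClique : ∀ {n} {A : Set} → (Fin n → Fin n → A) → ℕ → A → Set
HasMonoClique {n} h t a =
  Σ (Fin t → Fin n) λ f → (∀ x y → f x ≡ f y → x ≡ y) × (∀ x y → x ≢ y → h (f x) (f y) ≡ a)

module _ {n} {A B : Set} {h : Fin n → Fin n → A} {h′ : Fin n → Fin n → B} {a : A} {b : B} where

  hasMonoClique-transport : (∀ u w → u ≢ w → h u w ≡ a → h′ u w ≡ b) →
                            ∀ {t} → HasMonoClique h t a → HasMonoClique h′ t b
  hasMonoClique-transport h⇒h′ (f , f-inj , mono) =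
    f , f-inj , λ x y x≢y → h⇒h′ (f x) (f y) (x≢y ∘ f-inj x y) (mono x y x≢y)

hasMonoClique-≤ : ∀ {n} {A : Set} {h : Fin n → Fin n → A} {a s t} → s ≤ t →
                  HasMonoClique h t a → HasMonoClique h s a
hasMonoClique-≤ s≤t (f , f-inj , mono) =
  f ∘ (λ x → inject≤ x s≤t) ,
  (λ x y e → inject≤-injective s≤t s≤t x y (f-inj _ _ e)) ,
  (λ x y x≢y → mono _ _ (x≢y ∘ inject≤-injective s≤t s≤t x y))

hasMonoClique? : ∀ {n} {A : Set} → (∀ (a b : A) → Dec (a ≡ b)) →
                 ∀ (h : Fin n → Fin n → A) t a → Dec (HasMonoClique h t a)
hasMonoClique? {n} _≟A_ h t a = ∃-fun? resp λ f →
  (all? λ x → all? λ y → f x ≟ f y →-dec x ≟ y) ×-dec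
  (all? λ x → all? λ y → ¬? (x ≟ y) →-dec h (f x) (f y) ≟A a)
  where
  Clique : (Fin t → Fin n) → Set
  Clique f = (∀ x y → f x ≡ f y → x ≡ y) × (∀ x y → x ≢ y → h (f x) (f y) ≡ a)
  resp : ∀ {f g} → f ≗ g → Clique f → Clique g
  resp f≗g (f-inj , mono) =
    (λ x y e → f-inj x y (trans (f≗g x) (trans e (≡.sym (f≗g y))))) ,
    (λ x y x≢y → subst₂ (λ u w → h u w ≡ a) (f≗g x) (f≗g y) (mono x y x≢y))

module _ {n m : ℕ} .{{_ : NonZero m}} where

  switchAt : Fin n → ℕ → Colouring n m → Colouring n m
  switchAt v k c = record { col = switchCol m v k (col c) ; sym = switched-sym }
    where
    switched-sym : ∀ u w → switchCol m v k (col c) u w ≡ switchCol m v k (col c) w u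
    switched-sym u w = cong₂ (λ b x → if b then cycPow m k x else x)
                             (xor-comm ⌊ u ≟ v ⌋ ⌊ w ≟ v ⌋) (Colouring.sym c u w)

  -- Vertex u has been switched by cyc^(y u) in total; loops carry no information.
  SwitchedBy : (Fin n → ℕ) → Colouring n m → Colouring n m → Set
  SwitchedBy y c d = ∀ u w → u ≢ w → toℕ (col d u w) ≡ (toℕ (col c u w) + y u + y w) % m

  unitPotential : Fin n → ℕ → Fin n → ℕ
  unitPotential v k u = if ⌊ u ≟ v ⌋ then k else 0

  toℕ-switchCol : ∀ v k (g : Fin n → Fin n → Fin m) {u w} → u ≢ w →
                  toℕ (switchCol m v k g u w) ≡ (toℕ (g u w) + unitPotential v k u + unitPotential v k w) % m
  toℕ-switchCol v k g {u} {w} u≢w with u ≟ v | w ≟ v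
  ... | yes refl | yes refl = ⊥-elim (u≢w refl)
  ... | yes _    | no _     = trans (toℕ-cycPow m k (g u w)) (cong (_% m) (≡.sym (+-identityʳ _)))
  ... | no _     | yes _    = trans (toℕ-cycPow m k (g u w)) (cong (λ z → (z + k) % m) (≡.sym (+-identityʳ _)))
  ... | no _     | no _     = trans (toℕ≡toℕ%m m (g u w)) (cong (_% m) (≡.sym (x+0+0≡x _)))

  switchStep⇒switchedBy : ∀ {c d v k} → (∀ u w → col d u w ≡ switchCol m v k (col c) u w) →
                          SwitchedBy (unitPotential v k) c d
  switchStep⇒switchedBy {c} {v = v} {k} d≡ u w u≢w =
    trans (cong toℕ (d≡ u w)) (toℕ-switchCol v k (col c) u≢w)

  switchedBy-refl : ∀ {c} → SwitchedBy (λ _ → 0) c c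
  switchedBy-refl {c} u w _ = trans (toℕ≡toℕ%m m (col c u w)) (cong (_% m) (≡.sym (x+0+0≡x _)))

  switchedBy-trans : ∀ {y z c d e} → SwitchedBy y c d → SwitchedBy z d e → SwitchedBy (λ u → y u + z u) c e
  switchedBy-trans {y} {z} {c} {d} {e} c→d d→e u w u≢w = begin
    toℕ (col e u w)                           ≡⟨ d→e u w u≢w ⟩
    (toℕ (col d u w) + z u + z w) % m         ≡⟨ cong (λ k → (k + z u + z w) % m) (c→d u w u≢w) ⟩
    ((C + y u + y w) % m + z u + z w) % m     ≡⟨ cong (_% m) (+-assoc ((C + y u + y w) % m) (z u) (z w)) ⟩
    ((C + y u + y w) % m + (z u + z w)) % m   ≡⟨ [a%m+b]%m≡[a+b]%m m (C + y u + y w) (z u + z w) ⟩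
    (C + y u + y w + (z u + z w)) % m         ≡⟨ cong (_% m) (regroup C (y u) (y w) (z u) (z w)) ⟩
    (C + (y u + z u) + (y w + z w)) % m       ∎
    where
    open ≡-Reasoning
    open +-*-Solver
    C = toℕ (col c u w)
    regroup : ∀ c a b p q → c + a + b + (p + q) ≡ c + (a + p) + (b + q)
    regroup = solve 5 (λ c a b p q → c :+ a :+ b :+ (p :+ q) := c :+ (a :+ p) :+ (b :+ q)) refl

  switchedBy-cong : ∀ {y z c d} → y ≗ z → SwitchedBy y c d → SwitchedBy z c d
  switchedBy-cong {c = c} y≗z c→d u w u≢w =
    trans (c→d u w u≢w) (cong₂ (λ a b → (toℕ (col c u w) + a + b) % m) (y≗z u) (y≗z w))

  switchEquiv⇒switchedBy : ∀ {c d} → SwitchEquiv m c d → ∃ λ y → SwitchedBy y c d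
  switchEquiv⇒switchedBy {c} ε = _ , switchedBy-refl {c}
  switchEquiv⇒switchedBy {c} {d} (_◅_ {j = c₁} (v , k , c₁≡) rest) =
    _ , switchedBy-trans {c = c} {c₁} {d} (switchStep⇒switchedBy {c} {c₁} {v} {k} c₁≡)
                                           (proj₂ (switchEquiv⇒switchedBy rest))

  below : ℕ → (Fin n → ℕ) → Fin n → ℕ
  below j y u with toℕ u <? j
  ... | yes _ = y u
  ... | no _  = 0

  below-< : ∀ {j y u} → toℕ u < j → below j y u ≡ y u
  below-< {j} {u = u} u<j with toℕ u <? j
  ... | yes _   = refl
  ... | no u≮j  = ⊥-elim (u≮j u<j)

  below-≥ : ∀ {j y u} → j ≤ toℕ u → below j y u ≡ 0
  below-≥ {j} {u = u} j≤u with toℕ u <? j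
  ... | yes u<j = ⊥-elim (<-irrefl refl (<-≤-trans u<j j≤u))
  ... | no _    = refl

  below-suc : ∀ {j} (j<n : j < n) y u → let v = fromℕ< j<n in
              below j y u + unitPotential v (y v) u ≡ below (suc j) y u
  below-suc {j} j<n y u with u ≟ fromℕ< j<n
  ... | yes refl = begin
    below j y v + y v  ≡⟨ cong (_+ y v) (below-≥ (≤-reflexive (≡.sym (toℕ-fromℕ< j<n)))) ⟩
    y v                ≡⟨ ≡.sym (below-< (s≤s (≤-reflexive (toℕ-fromℕ< j<n)))) ⟩
    below (suc j) y v  ∎
    where
    open ≡-Reasoning
    v = fromℕ< j<n
  ... | no u≢v with ℕ-<-cmp (toℕ u) j
  ...   | tri< u<j _ _ = trans (+-identityʳ _) (trans (below-< u<j) (≡.sym (below-< (m≤n⇒m≤1+n u<j))))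
  ...   | tri≈ _ u≡j _ = ⊥-elim (u≢v (toℕ-injective (trans u≡j (≡.sym (toℕ-fromℕ< j<n)))))
  ...   | tri> _ _ j<u = trans (+-identityʳ _) (trans (below-≥ (<⇒≤ j<u)) (≡.sym (below-≥ j<u)))

  switchBelow : ∀ j → j ≤ n → ∀ y c → ∃ λ d → SwitchEquiv m c d × SwitchedBy (below j y) c d
  switchBelow zero    _   y c =
    c , ε , switchedBy-cong {c = c} {c} (λ u → ≡.sym (below-≥ {y = y} {u} ℕ.z≤n)) (switchedBy-refl {c})
  switchBelow (suc j) j<n y c with switchBelow j (<⇒≤ j<n) y c
  ... | d , c↝d , c→d =
    switchAt v (y v) d ,
    c↝d ◅◅ ((v , y v , λ _ _ → refl) ◅ ε) ,
    switchedBy-cong {c = c} {d′} (below-suc j<n y)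
      (switchedBy-trans {c = c} {d} {d′} c→d (switchStep⇒switchedBy {d} {d′} {v} {y v} λ _ _ → refl))
    where
    v = fromℕ< j<n
    d′ = switchAt v (y v) d

  switchedBy⇒switchEquiv : ∀ y c → ∃ λ d → SwitchEquiv m c d × SwitchedBy y c d
  switchedBy⇒switchEquiv y c with switchBelow n ≤-refl y c
  ... | d , c↝d , c→d = d , c↝d , switchedBy-cong {c = c} {d} (λ u → below-< (toℕ<n u)) c→d

module _ {n m : ℕ} .{{_ : NonZero m}} (b : Fin m → ℕ) where

  SwitchesToMono : Colouring n m → Set
  SwitchesToMono c = ∃[ c′ ] (SwitchEquiv m c c′ × ∃[ i ] ContainsMono c′ (b i) i)

  rotated : (Fin n → Fin n → Fin m) → (Fin n → Fin m) → Fin n → Fin n → ℕ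
  rotated g x u w = (toℕ (g u w) + toℕ (x u) + toℕ (x w)) % m

  -- Only the total rotation x u applied at each vertex matters, which turns the search over switching
  -- sequences into a finite one.
  MonoBySwitching : (Fin n → Fin n → Fin m) → Set
  MonoBySwitching g = ∃ λ x → ∃ λ i → HasMonoClique (rotated g x) (b i) (toℕ i)

  switchesToMono⇒monoBySwitching : ∀ c → SwitchesToMono c → MonoBySwitching (col c)
  switchesToMono⇒monoBySwitching c (c′ , c↝c′ , i , mono) with switchEquiv⇒switchedBy c↝c′
  ... | y , c→c′ = x , i , hasMonoClique-transport rotated≡i mono
    where
    x : Fin n → Fin m
    x u = fromℕ< (m%n<n (y u) m)
    rotated≡i : ∀ u w → u ≢ w → col c′ u w ≡ i → rotated (col c) x u w ≡ toℕ i
    rotated≡i u w u≢w c′≡i = begin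
      (C + toℕ (x u) + toℕ (x w)) % m  ≡⟨ cong₂ (λ p q → (C + p + q) % m) (toℕ-fromℕ< _) (toℕ-fromℕ< _) ⟩
      (C + y u % m + y w % m) % m      ≡⟨ [a+b%m+c%m]%m≡[a+b+c]%m m C (y u) (y w) ⟩
      (C + y u + y w) % m              ≡⟨ ≡.sym (c→c′ u w u≢w) ⟩
      toℕ (col c′ u w)                 ≡⟨ cong toℕ c′≡i ⟩
      toℕ i                            ∎
      where
      open ≡-Reasoning
      C = toℕ (col c u w)

  monoBySwitching⇒switchesToMono : ∀ c → MonoBySwitching (col c) → SwitchesToMono c
  monoBySwitching⇒switchesToMono c (x , i , mono) with switchedBy⇒switchEquiv (toℕ ∘ x) c
  ... | d , c↝d , c→d = d , c↝d , i ,
        hasMonoClique-transport (λ u w u≢w rotated≡i → toℕ-injective (trans (c→d u w u≢w) rotated≡i))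
                                mono

  monoBySwitching-resp : ∀ {g g′} → (∀ u → g u ≗ g′ u) → MonoBySwitching g → MonoBySwitching g′
  monoBySwitching-resp g≗g′ (x , i , mono) =
    x , i , hasMonoClique-transport
              (λ u w _ → trans (cong (λ k → (toℕ k + toℕ (x u) + toℕ (x w)) % m) (≡.sym (g≗g′ u w))))
              mono

  monoBySwitching? : ∀ g → Dec (MonoBySwitching g)
  monoBySwitching? g = ∃-fun? resp λ x → any? λ i → hasMonoClique? ℕ._≟_ (rotated g x) (b i) (toℕ i)
    where
    resp : ∀ {x x′} → x ≗ x′ → ∃ (λ i → HasMonoClique (rotated g x) (b i) (toℕ i)) →
           ∃ (λ i → HasMonoClique (rotated g x′) (b i) (toℕ i))
    resp x≗x′ (i , mono) =
      i , hasMonoClique-transport (λ u w _ → trans (cong₂ (λ p q → (toℕ (g u w) + toℕ p + toℕ q) % m)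
                                                          (≡.sym (x≗x′ u)) (≡.sym (x≗x′ w)))) mono

  arrows? : Dec (Arrows m b n)
  arrows? with ∃-fun₂? {P = Counterexample} counterexample-resp counterexample?
    where
    Counterexample : (Fin n → Fin n → Fin m) → Set
    Counterexample g = (∀ u w → g u w ≡ g w u) × ¬ MonoBySwitching g
    counterexample-resp : ∀ {g g′} → (∀ u → g u ≗ g′ u) → Counterexample g → Counterexample g′
    counterexample-resp g≗g′ (g-sym , ¬mono) =
      (λ u w → trans (≡.sym (g≗g′ u w)) (trans (g-sym u w) (g≗g′ w u))) ,
      ¬mono ∘ monoBySwitching-resp (λ u w → ≡.sym (g≗g′ u w))
    counterexample? : ∀ g → Dec (Counterexample g)
    counterexample? g = (all? λ u → all? λ w → g u w ≟ g w u) ×-dec ¬? (monoBySwitching? g)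
  ... | yes (g , g-sym , ¬mono) =
    no λ arrows → ¬mono (switchesToMono⇒monoBySwitching _ (arrows (record { col = g ; sym = g-sym })))
  ... | no ∄counterexample =
    yes λ c → monoBySwitching⇒switchesToMono c (decidable-stable (monoBySwitching? (col c))
                λ ¬mono → ∄counterexample (col c , Colouring.sym c , ¬mono))

length-filter-split : ∀ {A : Set} {P : A → Set} (P? : Decidable P) xs →
                      length xs ≡ length (filter P? xs) + length (filter (¬? ∘ P?) xs)
length-filter-split P? []       = refl
length-filter-split P? (x ∷ xs) with P? x
... | yes _ = cong suc (length-filter-split P? xs)
... | no _  = trans (cong suc (length-filter-split P? xs)) (≡.sym (+-suc _ _))

pigeonhole : ∀ {A : Set} (g : A → ℕ) m t (xs : List A) → All (λ x → g x < m) xs → m * t < length xs →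
             ∃ λ j → j < m × t < length (filter (λ x → g x ℕ.≟ j) xs)
pigeonhole g zero    t (x ∷ _) (() ∷ _) _
pigeonhole g (suc m) t xs g<1+m t+mt<len with t <? length (filter (λ x → g x ℕ.≟ m) xs)
... | yes t<count = m , ≤-refl , t<count
... | no t≮count with pigeonhole g m t rest rest-bounded rest-large
  where
  rest = filter (λ x → ¬? (g x ℕ.≟ m)) xs
  rest-bounded : All (λ x → g x < m) rest
  rest-bounded = All.zipWith (λ (g<1+m , g≢m) → ≤∧≢⇒< (ℕ.s≤s⁻¹ g<1+m) g≢m)
                             (All.filter⁺ _ g<1+m , All.all-filter _ xs)
  rest-large : m * t < length rest
  rest-large = +-cancelˡ-< t _ _ (begin-strict
    t + m * t                                   <⟨ t+mt<len ⟩
    length xs                                   ≡⟨ length-filter-split (λ x → g x ℕ.≟ m) xs ⟩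
    length (filter (λ x → g x ℕ.≟ m) xs) + length rest
                                                ≤⟨ +-monoˡ-≤ (length rest) (≮⇒≥ t≮count) ⟩
    t + length rest                             ∎)
    where open ≤-Reasoning
... | j , j<m , t<count = j , m≤n⇒m≤1+n j<m ,
  <-≤-trans t<count (length-mono-≤ (Sublist.filter⁺ _ _ (λ { refl p → p }) (filter-⊆ _ xs)))

toℕ≡⇒≡fromℕ< : ∀ {m j} (j<m : j < m) {i : Fin m} → toℕ i ≡ j → i ≡ fromℕ< j<m
toℕ≡⇒≡fromℕ< j<m i≡j = toℕ-injective (trans i≡j (≡.sym (toℕ-fromℕ< j<m)))

allPairs-lookup : ∀ {A : Set} {R : A → A → Set} {xs} → AllPairs R xs →
                  ∀ {i j} → i Fin.< j → R (lookup xs i) (lookup xs j)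
allPairs-lookup (Rx ∷ _)    {Fin.zero}  {Fin.suc j} _         = All.lookup Rx (∈-lookup j)
allPairs-lookup (_ ∷ pairs) {Fin.suc i} {Fin.suc j} (s≤s i<j) = allPairs-lookup pairs i<j

chainBound : ℕ → ℕ → ℕ
chainBound m zero    = 0
chainBound m (suc L) = suc (m * chainBound m L)

module _ {n m} (c : Colouring n m) where

  -- In a chain, each vertex is joined to all later vertices by edges of one colour.
  ChainLink : Fin n × Fin m → Fin n × Fin m → Set
  ChainLink (v , j) (w , _) = v ≢ w × col c v w ≡ j

  chain : ∀ L (S : List (Fin n)) → Unique S → chainBound m L < length S →
          ∃ λ ch → AllPairs ChainLink ch × length ch ≡ L × map proj₁ ch ⊆ S
  chain zero    S        _               _             = [] , [] , refl , minimum S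
  chain (suc L) (v ∷ S′) (v∉S′ ∷ S′-unique) (s≤s bound)
    with pigeonhole (toℕ ∘ col c v) m (chainBound m L) S′ (All.tabulate (λ {w} _ → toℕ<n (col c v w))) bound
  ... | j , j<m , large
    with chain L (filter (λ w → toℕ (col c v w) ℕ.≟ j) S′) (Unique.filter⁺ _ S′-unique) large
  ... | ch , ch-chain , ch-length , ch⊆ =
    (v , fromℕ< j<m) ∷ ch , All.map⁻ (All-resp-⊆ ch⊆ links) ∷ ch-chain , cong suc ch-length ,
    refl ∷ ⊆-trans ch⊆ (filter-⊆ _ S′)
    where
    links : All (λ w → v ≢ w × col c v w ≡ fromℕ< j<m) (filter (λ w → toℕ (col c v w) ℕ.≟ j) S′)
    links = All.zipWith (λ (v≢w , colour≡j) → v≢w , toℕ≡⇒≡fromℕ< j<m colour≡j)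
                        (All.filter⁺ _ v∉S′ , All.all-filter _ S′)

  chain⇒containsMono : ∀ {ch t i} → AllPairs ChainLink ch → All (λ p → proj₂ p ≡ i) ch →
                       t ≤ length ch → ContainsMono c t i
  chain⇒containsMono {ch} {t} {i} ch-chain coloured t≤len =
    hasMonoClique-≤ {h = col c} t≤len (vertex , vertex-injective , λ x y x≢y → proj₂ (link x≢y))
    where
    vertex : Fin (length ch) → Fin n
    vertex = proj₁ ∘ lookup ch
    link : ∀ {x y} → x ≢ y → vertex x ≢ vertex y × col c (vertex x) (vertex y) ≡ i
    link {x} {y} x≢y with <-cmp x y
    ... | tri< x<y _ _ = let (v≢w , colour) = allPairs-lookup ch-chain x<y in
                         v≢w , trans colour (All.lookup coloured (∈-lookup x))
    ... | tri≈ _ x≡y _ = ⊥-elim (x≢y x≡y)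
    ... | tri> _ _ y<x = let (w≢v , colour) = allPairs-lookup ch-chain y<x in
                         w≢v ∘ ≡.sym ,
                         trans (Colouring.sym c _ _) (trans colour (All.lookup coloured (∈-lookup y)))
    vertex-injective : ∀ x y → vertex x ≡ vertex y → x ≡ y
    vertex-injective x y v≡w with x ≟ y
    ... | yes x≡y = x≡y
    ... | no x≢y  = ⊥-elim (proj₁ (link x≢y) v≡w)

ramsey : ∀ m t → ∃ λ n → ∀ (c : Colouring n m) → ∃ λ i → ContainsMono c t i
ramsey m t = suc (chainBound m L) , mono
  where
  L = suc (m * t)
  mono : ∀ c → ∃ λ i → ContainsMono c t i
  mono c with chain c L (allFin _) (Unique.allFin⁺ _) (≤-reflexive (≡.sym (length-tabulate (λ x → x))))
  ... | ch , ch-chain , ch-length , _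
    with pigeonhole (toℕ ∘ proj₂) m t ch (All.tabulate (λ {p} _ → toℕ<n (proj₂ p)))
                    (≤-reflexive (≡.sym ch-length))
  ... | j , j<m , large =
    fromℕ< j<m ,
    chain⇒containsMono c (AllPairs.filter⁺ _ ch-chain)
      (All.map (toℕ≡⇒≡fromℕ< j<m) (All.all-filter _ ch))
      (<⇒≤ large)

module _ {n m : ℕ} .{{_ : NonZero m}} (m%2≡1 : m % 2 ≡ 1) where

  -- Switching every vertex by the same h adds 2h to every colour, and 2 is invertible modulo m.
  recolour : ∀ {c c′ : Colouring n m} {t i} → SwitchEquiv m c c′ → ContainsMono c′ t i →
             ∀ j → ∃ λ c″ → SwitchEquiv m c c″ × ContainsMono c″ t j
  recolour {c′ = c′} {i = i} c↝c′ mono j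
    with odd⇒halvable m m%2≡1 (toℕ i) (toℕ j) (<⇒≤ (toℕ<n i))
  ... | h , i+2h≡j with switchedBy⇒switchEquiv (λ _ → h) c′
  ... | c″ , c′↝c″ , c′→c″ =
    c″ , c↝c′ ◅◅ c′↝c″ , hasMonoClique-transport {h = col c′} recoloured mono
    where
    recoloured : ∀ u w → u ≢ w → col c′ u w ≡ i → col c″ u w ≡ j
    recoloured u w u≢w c′≡i = toℕ-injective (begin
      toℕ (col c″ u w)                ≡⟨ c′→c″ u w u≢w ⟩
      (toℕ (col c′ u w) + h + h) % m  ≡⟨ cong (λ k → (toℕ k + h + h) % m) c′≡i ⟩
      (toℕ i + h + h) % m             ≡⟨ i+2h≡j ⟩
      toℕ j % m                       ≡⟨ ≡.sym (toℕ≡toℕ%m m j) ⟩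
      toℕ j                           ∎)
      where open ≡-Reasoning

  arrows-const⇒arrows : ∀ (a : Fin m → ℕ) j → Arrows m (λ _ → a j) n → Arrows m a n
  arrows-const⇒arrows a j arrows c with arrows c
  ... | c′ , c↝c′ , i , mono with recolour c↝c′ mono j
  ... | c″ , c↝c″ , mono′ = c″ , c↝c″ , j , mono′

arrows-mono : ∀ {n m} .{{_ : NonZero m}} {a b : Fin m → ℕ} →
              (∀ i → b i ≤ a i) → Arrows m a n → Arrows m b n
arrows-mono b≤a arrows c with arrows c
... | c′ , c↝c′ , i , mono = c′ , c↝c′ , i , hasMonoClique-≤ {h = col c′} (b≤a i) mono

isRamseyC-resp : ∀ {m} .{{_ : NonZero m}} {a b n} → (∀ {k} → Arrows m a k → Arrows m b k) →
                 (∀ {k} → Arrows m b k → Arrows m a k) → IsRamseyC m a n → IsRamseyC m b n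
isRamseyC-resp a⇒b b⇒a (arrows , minimal) = a⇒b arrows , λ k arrows′ → minimal k (b⇒a arrows′)

ramseyC-exists : ∀ m .{{_ : NonZero m}} t → ∃ (IsRamseyC m (λ _ → t))
ramseyC-exists m t with ramsey m t
... | n , mono = least (λ k → arrows? (λ _ → t)) {n} (λ c → c , ε , mono c)

theorem22 : (m : ℕ) → .{{_ : NonZero m}} → m % 2 ≡ 1 →
            (a : Fin m → ℕ) → (∀ i → 2 ≤ a i) →
            (N : ℕ) → (∃[ j ] a j ≡ N) → (∀ i → N ≤ a i) →
            ∃[ n ] (IsRamseyC m a n × IsRamseyC m (λ _ → N) n)
theorem22 m m%2≡1 a _ .(a j) (j , refl) N≤a with ramseyC-exists m (a j)
... | n , isRamsey = n , isRamseyC-resp (arrows-const⇒arrows m%2≡1 a j) (arrows-mono N≤a) isRamsey , isRamsey
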